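{- Let $\mathfrak F=(W,R,\mathcal P)$ be an $n$-generated temporal descriptive frame, for some $n<\omega$. Then (a) every cluster in $\mathfrak F$ has at most $2^n$ points; (b) every $R$-unbounded set of clusters in $\mathfrak F$ has an $R$-limit in $\mathfrak F$, and every $R^-$-unbounded set of clusters has an $R^-$-limit in $\mathfrak F$; consequently $\mathfrak F$ contains both an $R$-final and an $R^-$-final cluster.
   Context: A temporal frame $(W,R,\mathcal P)$: $R$ transitive and connected on $W\ne\emptyset$ ($xRy$ or $x=y$ or $yRx$), $\mathcal P\subseteq2^W$ containing $\emptyset,W$, closed under $\cap$, complement, $\Diamond_FX=\{x\mid\exists y\in X\,xRy\}$ and $\Diamond_PX=\{x\mid\exists y\in X\,yRx\}$; $R^-$ is the inverse of $R$. It is $n$-generated if $\mathcal P$ is generated by an $n$-element subset under these operations. Descriptive: (dif) distinct points are separated by a set in $\mathcal P$; (tig) $xRy$ iff for all $X\in\mathcal P$, $y\in X\Rightarrow x\in\Diamond_FX$; (com) every subfamily of $\mathcal P$ with the finite intersection property has nonempty intersection. Cluster $C(x)=\{x\}\cup\{y\mid xRy\wedge yRx\}$; $C(x)<_RC(y)$ iff $xRy$ and not $yRx$; $\le_R$ its reflexive closure. A cluster is $R$-final if no cluster is $<_R$-above it and $R^-$-final if none is $<_R$-below it. A nonempty set $S$ of clusters is $R$-unbounded if there is no $C\in S$ with $C'\le_RC$ for all $C'\in S$, and $R^-$-unbounded if there is no $C\in S$ with $C\le_RC'$ for all $C'\in S$. A cluster $C$ is the $R$-limit of an $R$-unbounded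 $S$ if $C'<_RC$ for all $C'\in S$ and there is no $C''$ with $C'<_RC''<_RC$ for all $C'\in S$; the $R^-$-limit of an $R^-$-unbounded $S$ is defined symmetrically ($C<_RC'$ for all $C'\in S$ and no $C''$ with $C<_RC''<_RC'$ for all $C'\in S$). -}

module Defs where

open import Level using (Level) renaming (suc to lsuc; zero to lzero)
open import Data.Nat using (ℕ; _≤_; _^_)
open import Data.Fin using (Fin)
open import Data.List using (List; length)
open import Data.List.Relation.Unary.All using (All)
open import Data.List.Relation.Unary.Unique.Propositional using (Unique)
open import Data.Product using (Σ; ∃; _×_)
open import Data.Sum using (_⊎_)
open import Data.Empty using (⊥)
open import Data.Unit using (⊤)
open import Relation.Nullary using (¬_)
open import Relation.Binary.PropositionalEquality using (_≡_; _≢_)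
open import Function.Bundles using (_⇔_)

Subset : Set → Set₁
Subset W = W → Set

∅ₛ : {W : Set} → Subset W
∅ₛ _ = ⊥

Wₛ : {W : Set} → Subset W
Wₛ _ = ⊤

_∩ₛ_ : {W : Set} → Subset W → Subset W → Subset W
(X ∩ₛ Y) x = X x × Y x

∁ₛ : {W : Set} → Subset W → Subset W
∁ₛ X x = ¬ X x

◇F : {W : Set} → (W → W → Set) → Subset W → Subset W
◇F R X x = Σ _ λ y → X y × R x y

◇P : {W : Set} → (W → W → Set) → Subset W → Subset W
◇P R X x = Σ _ λ y → X y × R y x

_≐_ : {W : Set} → Subset W → Subset W → Set
X ≐ Y = ∀ x → X x ⇔ Y x

record TemporalFrame : Set₂ where
  field
    W          : Set
    R          : W → W → Set
    𝒫          : Subset W → Set₁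
    inhabited  : W
    trans      : ∀ {x y z} → R x y → R y z → R x z
    connected  : ∀ x y → R x y ⊎ (x ≡ y ⊎ R y x)
    𝒫-∅        : 𝒫 ∅ₛ
    𝒫-W        : 𝒫 Wₛ
    𝒫-∩        : ∀ {X Y} → 𝒫 X → 𝒫 Y → 𝒫 (X ∩ₛ Y)
    𝒫-∁        : ∀ {X} → 𝒫 X → 𝒫 (∁ₛ X)
    𝒫-◇F       : ∀ {X} → 𝒫 X → 𝒫 (◇F R X)
    𝒫-◇P       : ∀ {X} → 𝒫 X → 𝒫 (◇P R X)

data Term (n : ℕ) : Set where
  var  : Fin n → Term n
  bot  : Term n
  top  : Term n
  _∧ₜ_ : Term n → Term n → Term n
  neg  : Term n → Term n
  dF   : Term n → Term n
  dP   : Term n → Term n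

⟦_⟧ : {n : ℕ} {W : Set} → Term n → (W → W → Set) → (Fin n → Subset W) → Subset W
⟦ var i ⟧   R g = g i
⟦ bot ⟧     R g = ∅ₛ
⟦ top ⟧     R g = Wₛ
⟦ s ∧ₜ t ⟧  R g = ⟦ s ⟧ R g ∩ₛ ⟦ t ⟧ R g
⟦ neg t ⟧   R g = ∁ₛ (⟦ t ⟧ R g)
⟦ dF t ⟧    R g = ◇F R (⟦ t ⟧ R g)
⟦ dP t ⟧    R g = ◇P R (⟦ t ⟧ R g)

module _ (F : TemporalFrame) where
  open TemporalFrame F

  NGenerated : ℕ → Set₁
  NGenerated n = Σ (Fin n → Subset W) λ g →
      (∀ i → 𝒫 (g i))
    × (∀ i j → g i ≐ g j → i ≡ j)
    × (∀ X → 𝒫 X → Σ (Term n) λ t → X ≐ ⟦ t ⟧ R g)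

  FIP : (Subset W → Set₁) → Set₁
  FIP 𝒬 = (Xs : List (Subset W)) → All 𝒬 Xs → Σ W λ x → All (λ X → X x) Xs

  record Descriptive : Set₂ where
    field
      dif : ∀ x y → x ≢ y → Σ (Subset W) λ X → 𝒫 X × X x × ¬ X y
      tig : ∀ x y → R x y ⇔ (∀ X → 𝒫 X → X y → ◇F R X x)
      com : (𝒬 : Subset W → Set₁) → (∀ X → 𝒬 X → 𝒫 X) → FIP 𝒬
            → Σ W λ x → ∀ X → 𝒬 X → X x

  C : W → Subset W
  C x y = y ≡ x ⊎ (R x y × R y x)

  -- A set of clusters is represented by a set S of points: it denotes
  -- {C(x) | x ∈ S}.  Order on clusters via representatives:
  -- C(x) <_R C(y) iff xRy and not yRx.
  _<C_ : W → W → Set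
  x <C y = R x y × ¬ R y x

  _≤C_ : W → W → Set
  x ≤C y = x <C y ⊎ C x ≐ C y

  RUnbounded : Subset W → Set
  RUnbounded S = (Σ W S) × ¬ (Σ W λ c → S c × (∀ c' → S c' → c' ≤C c))

  R⁻Unbounded : Subset W → Set
  R⁻Unbounded S = (Σ W S) × ¬ (Σ W λ c → S c × (∀ c' → S c' → c ≤C c'))

  IsRLimit : Subset W → W → Set
  IsRLimit S c = (∀ c' → S c' → c' <C c)
               × ¬ (Σ W λ c'' → (∀ c' → S c' → c' <C c'') × c'' <C c)

  IsR⁻Limit : Subset W → W → Set
  IsR⁻Limit S c = (∀ c' → S c' → c <C c')
                × ¬ (Σ W λ c'' → c <C c'' × (∀ c' → S c' → c'' <C c'))

  IsRFinal : W → Set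
  IsRFinal c = ¬ (Σ W λ c' → c <C c')

  IsR⁻Final : W → Set
  IsR⁻Final c = ¬ (Σ W λ c' → c' <C c)

-- (a) Within a cluster, transitivity makes ◇F and ◇P take the same value at every point, so
-- the members of 𝒫 (terms in the n generators) containing a point are fixed by which
-- generators contain it; by (dif) a cluster therefore has at most 2ⁿ points.
-- (b) If S has no greatest cluster, the members of 𝒫 containing a final segment of S or the
-- past of an upper bound of S have the finite intersection property; a point c in their
-- intersection, found by (com), lies strictly above S by (tig) and below every strict upper
-- bound of S, again by (tig). The R⁻ case is the same argument in the mirror frame
-- (R reversed), which is descriptive as well; a frame without final cluster is itself
-- strictly increasing and its limit would lie above itself.

module Submission where

open import Defs
open import Level using () renaming (zero to lzero; suc to lsuc)
open import Axiom.ExcludedMiddle using (ExcludedMiddle)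
open import Data.Nat using (ℕ; _≤_; _^_)
open import Data.List using (List; length)
open import Data.List.Relation.Unary.All using (All)
open import Data.List.Relation.Unary.Unique.Propositional using (Unique)
open import Data.Product using (Σ; _×_)

open import Axiom.DoubleNegationElimination using (em⇒dne)
open import Data.Empty using (⊥-elim)
open import Data.Fin using (Fin; zero; suc; finToFun; funToFin)
open import Data.Fin.Properties using (finToFun-funToFin; injective⇒≤)
open import Data.List using (lookup)
open import Data.List.Membership.Propositional.Properties using (∈-lookup)
open import Data.List.Relation.Unary.All as All using ([]; _∷_)
open import Data.List.Relation.Unary.AllPairs using (_∷_)
open import Data.Product using (_,_; proj₁; proj₂)
open import Data.Sum using (_⊎_; inj₁; inj₂; map₂; map₁)
open import Data.Unit using (⊤; tt)
open import Function using (flip)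
open import Function.Bundles using (_⇔_; mk⇔; Equivalence)
open import Function.Construct.Identity using (⇔-id)
open import Function.Construct.Symmetry using (⇔-sym)
open import Relation.Binary.Definitions using (Transitive)
open import Relation.Binary.PropositionalEquality
  using (_≡_; _≢_; refl; sym; cong; module ≡-Reasoning)
open import Relation.Nullary using (¬_; Dec; yes; no)

lookup-injective : ∀ {A : Set} {xs : List A} → Unique xs →
                   ∀ i j → lookup xs i ≡ lookup xs j → i ≡ j
lookup-injective (_ ∷ _)    zero    zero    _  = refl
lookup-injective (x∉xs ∷ _) zero    (suc j) eq = ⊥-elim (All.lookup x∉xs (∈-lookup j) eq)
lookup-injective (x∉xs ∷ _) (suc i) zero    eq = ⊥-elim (All.lookup x∉xs (∈-lookup i) (sym eq))
lookup-injective (_ ∷ u)    (suc i) (suc j) eq = cong suc (lookup-injective u i j eq)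

injectiveOn⇒length≤ : ∀ {A : Set} {P : A → Set} {k} {xs : List A} (f : A → Fin k) →
                      (∀ {x y} → P x → P y → f x ≡ f y → x ≡ y) →
                      Unique xs → All P xs → length xs ≤ k
injectiveOn⇒length≤ {P = P} {xs = xs} f f-inj xs-unique xs⊆P =
  injective⇒≤ λ {i} {j} eq → lookup-injective xs-unique i j (f-inj (P-at i) (P-at j) eq)
  where
  P-at : ∀ i → P (lookup xs i)
  P-at i = All.lookup xs⊆P (∈-lookup i)

funToFin-injective : ∀ {m n} {f h : Fin m → Fin n} →
                     funToFin f ≡ funToFin h → ∀ i → f i ≡ h i
funToFin-injective {f = f} {h} eq i = begin
  f i                     ≡⟨ sym (finToFun-funToFin f i) ⟩
  finToFun (funToFin f) i ≡⟨ cong (λ k → finToFun k i) eq ⟩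
  finToFun (funToFin h) i ≡⟨ finToFun-funToFin h i ⟩
  h i                     ∎
  where open ≡-Reasoning

indicator : ∀ {P : Set} → Dec P → Fin 2
indicator (yes _) = suc zero
indicator (no _)  = zero

indicator-≡⇒ : ∀ {P Q : Set} (p : Dec P) (q : Dec Q) → indicator p ≡ indicator q → P → Q
indicator-≡⇒ _       (yes q) _  _ = q
indicator-≡⇒ (yes _) (no _)  ()
indicator-≡⇒ (no ¬p) (no _)  _  p = ⊥-elim (¬p p)

module _ {W : Set} {R : W → W → Set} (R-trans : Transitive R) {n} (g : Fin n → Subset W) where

  ⟦⟧-respects-generators : ∀ {y z} → R y z → R z y → (∀ i → g i y ⇔ g i z) →
                           ∀ t → ⟦ t ⟧ R g y → ⟦ t ⟧ R g z
  ⟦⟧-respects-generators Ryz Rzy g≡ (var i)  p        = Equivalence.to (g≡ i) p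
  ⟦⟧-respects-generators Ryz Rzy g≡ bot      p        = p
  ⟦⟧-respects-generators Ryz Rzy g≡ top      p        = p
  ⟦⟧-respects-generators Ryz Rzy g≡ (s ∧ₜ t) (p , q)  =
    ⟦⟧-respects-generators Ryz Rzy g≡ s p , ⟦⟧-respects-generators Ryz Rzy g≡ t q
  ⟦⟧-respects-generators Ryz Rzy g≡ (neg t)  ¬p q     =
    ¬p (⟦⟧-respects-generators Rzy Ryz (λ i → ⇔-sym (g≡ i)) t q)
  ⟦⟧-respects-generators Ryz Rzy g≡ (dF t)   (w , p , Ryw) = w , p , R-trans Rzy Ryw
  ⟦⟧-respects-generators Ryz Rzy g≡ (dP t)   (w , p , Rwy) = w , p , R-trans Rwy Ryz

module _ (F : TemporalFrame) where
  open TemporalFrame F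

  infix 4 _≺_
  _≺_ : W → W → Set
  _≺_ = _<C_ F

  C-≐ : ∀ {x y} → R x y → R y x → C F x ≐ C F y
  C-≐ Rxy Ryx w = mk⇔ (into Rxy Ryx) (into Ryx Rxy)
    where
    into : ∀ {x y} → R x y → R y x → C F x w → C F y w
    into Rxy Ryx (inj₁ refl)        = inj₂ (Ryx , Rxy)
    into Rxy Ryx (inj₂ (Rxw , Rwx)) = inj₂ (trans Ryx Rxw , trans Rwx Rxy)

  cluster-mutual : ∀ {x y z} → C F x y → C F x z → y ≢ z → R y z × R z y
  cluster-mutual (inj₁ refl)        (inj₁ refl)        y≢z = ⊥-elim (y≢z refl)
  cluster-mutual (inj₁ refl)        (inj₂ (Ryz , Rzy)) _   = Ryz , Rzy
  cluster-mutual (inj₂ (Rxy , Ryx)) (inj₁ refl)        _   = Ryx , Rxy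
  cluster-mutual (inj₂ (Rxy , Ryx)) (inj₂ (Rxz , Rzx)) _   = trans Ryx Rxz , trans Rzx Rxy

  module _ (em : ExcludedMiddle lzero) where
    private
      dne = em⇒dne em

    ≮⇒≥ : ∀ {x y} → ¬ x ≺ y → _≤C_ F y x
    ≮⇒≥ {x} {y} x⊀y with connected x y
    ... | inj₁ Rxy         = inj₂ (C-≐ (dne λ ¬Ryx → x⊀y (Rxy , ¬Ryx)) Rxy)
    ... | inj₂ (inj₁ refl) = inj₂ (λ w → ⇔-id _)
    ... | inj₂ (inj₂ Ryx)  with em {R x y}
    ...   | yes Rxy = inj₂ (C-≐ Ryx Rxy)
    ...   | no ¬Rxy = inj₁ (Ryx , ¬Rxy)

    RUnbounded⇒successor : ∀ {S} → RUnbounded F S →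
                           ∀ s → S s → Σ W λ s' → S s' × s ≺ s'
    RUnbounded⇒successor (_ , no-max) s Ss = dne λ no-successor →
      no-max (s , Ss , λ c Sc → ≮⇒≥ λ s≺c → no-successor (c , Sc , s≺c))

    R⁻Unbounded⇒predecessor : ∀ {S} → R⁻Unbounded F S →
                              ∀ s → S s → Σ W λ s' → S s' × s' ≺ s
    R⁻Unbounded⇒predecessor (_ , no-min) s Ss = dne λ no-predecessor →
      no-min (s , Ss , λ c Sc → ≮⇒≥ λ c≺s → no-predecessor (c , Sc , c≺s))

  module Limit (D : Descriptive F) (em : ExcludedMiddle lzero)
               (S : Subset W) (s₀ : W) (Ss₀ : S s₀)
               (successor : ∀ s → S s → Σ W λ s' → S s' × s ≺ s') where
    open Descriptive D
    private
      dne = em⇒dne em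

    Eventually : ∀ {ℓ} → (W → Set ℓ) → Set ℓ
    Eventually X = Σ W λ b → S b × (∀ z → S z → R b z → X z)

    UpperBound : Subset W
    UpperBound u = ∀ s → S s → R s u

    𝒬 : Subset W → Set₁
    𝒬 X = 𝒫 X × ((Σ W λ s → S s × (∀ z → R s z → X z))
                 ⊎ (Σ W λ u → UpperBound u × (∀ z → R z u → X z)))

    𝒬⇒Eventually : ∀ {X} → 𝒬 X → Eventually X
    𝒬⇒Eventually (_ , inj₁ (s , Ss , after-s⊆X))  =
      s , Ss , λ z _ Rsz → after-s⊆X z Rsz
    𝒬⇒Eventually (_ , inj₂ (u , u-ub , before-u⊆X)) =
      s₀ , Ss₀ , λ z Sz _ → before-u⊆X z (u-ub z Sz)

    Eventually-× : ∀ {ℓ ℓ'} {X : W → Set ℓ} {Y : W → Set ℓ'} →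
                   Eventually X → Eventually Y → Eventually (λ z → X z × Y z)
    Eventually-× (b , Sb , hX) (b' , Sb' , hY) with connected b b'
    ... | inj₁ Rbb'        = b' , Sb' , λ z Sz Rb'z → hX z Sz (trans Rbb' Rb'z) , hY z Sz Rb'z
    ... | inj₂ (inj₁ refl) = b  , Sb  , λ z Sz Rbz  → hX z Sz Rbz , hY z Sz Rbz
    ... | inj₂ (inj₂ Rb'b) = b  , Sb  , λ z Sz Rbz  → hX z Sz Rbz , hY z Sz (trans Rb'b Rbz)

    Eventually-All : ∀ {Xs : List (Subset W)} →
                     All (λ X → Eventually X) Xs → Eventually (λ z → All (λ X → X z) Xs)
    Eventually-All []       = s₀ , Ss₀ , λ _ _ _ → []
    Eventually-All (e ∷ es) with Eventually-× e (Eventually-All es)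
    ... | b , Sb , h = b , Sb , λ z Sz Rbz → proj₁ (h z Sz Rbz) ∷ proj₂ (h z Sz Rbz)

    𝒬-fip : FIP F 𝒬
    𝒬-fip Xs 𝒬Xs with Eventually-All (All.map 𝒬⇒Eventually 𝒬Xs)
    ... | b , Sb , h with successor b Sb
    ...   | s , Ss , (Rbs , _) = s , h s Ss Rbs

    c : W
    c = proj₁ (com 𝒬 (λ _ → proj₁) 𝒬-fip)

    c∈⋂𝒬 : ∀ X → 𝒬 X → X c
    c∈⋂𝒬 = proj₂ (com 𝒬 (λ _ → proj₁) 𝒬-fip)

    tight : ∀ {x y} → (∀ X → 𝒫 X → X y → ◇F R X x) → R x y
    tight = Equivalence.from (tig _ _)

    S-below-c : ∀ s → S s → R s c
    S-below-c s Ss = tight λ X 𝒫X Xc → dne λ ¬◇X →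
      c∈⋂𝒬 (∁ₛ X) (𝒫-∁ 𝒫X , inj₁ (s , Ss , λ z Rsz Xz → ¬◇X (z , Xz , Rsz))) Xc

    S-strictly-below-c : ∀ s → S s → s ≺ c
    S-strictly-below-c s Ss with successor s Ss
    ... | s' , Ss' , (_ , ¬Rs's) =
      S-below-c s Ss , λ Rcs → ¬Rs's (trans (S-below-c s' Ss') Rcs)

    -- ◇F X contains everything below u, so it belongs to 𝒬.
    c-least : ¬ (Σ W λ u → (∀ s → S s → s ≺ u) × u ≺ c)
    c-least (u , S≺u , (_ , ¬Rcu)) = ¬Rcu (tight λ X 𝒫X Xu →
      c∈⋂𝒬 (◇F R X) (𝒫-◇F 𝒫X , inj₂ (u , (λ s Ss → proj₁ (S≺u s Ss)) , λ z Rzu → u , Xu , Rzu)))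

    limit : Σ W (IsRLimit F S)
    limit = c , S-strictly-below-c , c-least

  RLimit-of-RUnbounded : Descriptive F → ExcludedMiddle lzero →
                         ∀ S → RUnbounded F S → Σ W (IsRLimit F S)
  RLimit-of-RUnbounded D em S unbounded@((s₀ , Ss₀) , _) =
    Limit.limit D em S s₀ Ss₀ (RUnbounded⇒successor em unbounded)

  RFinal-exists : Descriptive F → ExcludedMiddle lzero → Σ W (IsRFinal F)
  RFinal-exists D em = dne λ no-final →
    W-has-no-limit (Limit.limit D em (λ _ → ⊤) inhabited tt (successor no-final))
    where
    dne = em⇒dne em

    successor : ¬ Σ W (IsRFinal F) → ∀ s → ⊤ → Σ W λ s' → ⊤ × s ≺ s'
    successor no-final s _ = dne λ no-successor →
      no-final (s , λ (s' , s≺s') → no-successor (s' , tt , s≺s'))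

    W-has-no-limit : ¬ Σ W (IsRLimit F (λ _ → ⊤))
    W-has-no-limit (c , W≺c , _) = proj₂ (W≺c c tt) (proj₁ (W≺c c tt))

  module ClusterSize (D : Descriptive F) (em : ExcludedMiddle lzero) {n} (g : Fin n → Subset W)
                     (g-generates : ∀ X → 𝒫 X → Σ (Term n) λ t → X ≐ ⟦ t ⟧ R g) where
    open Descriptive D

    type : W → Fin n → Fin 2
    type y i = indicator (em {g i y})

    type-injectiveOn-cluster : ∀ {x y z} → C F x y → C F x z →
                               funToFin (type y) ≡ funToFin (type z) → y ≡ z
    type-injectiveOn-cluster {y = y} {z} Cxy Cxz same-type = em⇒dne em λ y≢z →
      let (X , 𝒫X , Xy , ¬Xz) = dif y z y≢z
          (t , X≐t)           = g-generates X 𝒫X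
          (Ryz , Rzy)         = cluster-mutual Cxy Cxz y≢z
      in ¬Xz (Equivalence.from (X≐t z)
               (⟦⟧-respects-generators trans g Ryz Rzy same-generators t
                 (Equivalence.to (X≐t y) Xy)))
      where
      same-generators : ∀ i → g i y ⇔ g i z
      same-generators i = mk⇔ (indicator-≡⇒ em em (funToFin-injective same-type i))
                              (indicator-≡⇒ em em (sym (funToFin-injective same-type i)))

    cluster-size : ∀ x (ys : List W) → Unique ys → All (C F x) ys → length ys ≤ 2 ^ n
    cluster-size x ys =
      injectiveOn⇒length≤ (λ y → funToFin (type y)) type-injectiveOn-cluster

mirror : TemporalFrame → TemporalFrame
mirror F = record
  { W         = W
  ; R         = flip R
  ; 𝒫         = 𝒫
  ; inhabited = inhabited
  ; trans     = λ Ryx Rzy → trans Rzy Ryx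
  ; connected = λ x y → map₂ (map₁ sym) (connected y x)
  ; 𝒫-∅       = 𝒫-∅
  ; 𝒫-W       = 𝒫-W
  ; 𝒫-∩       = 𝒫-∩
  ; 𝒫-∁       = 𝒫-∁
  ; 𝒫-◇F      = 𝒫-◇P
  ; 𝒫-◇P      = 𝒫-◇F
  }
  where open TemporalFrame F

mirror-descriptive : (F : TemporalFrame) → Descriptive F →
                     ExcludedMiddle lzero → ExcludedMiddle (lsuc lzero) → Descriptive (mirror F)
mirror-descriptive F D em₀ em₁ = record
  { dif = dif
  ; tig = λ x y → mk⇔ (λ Ryx X _ Xy → y , Xy , Ryx) past-tight
  ; com = com
  }
  where
  open TemporalFrame F
  open Descriptive D

  separator : ∀ {x y} → ¬ R y x → Σ (Subset W) λ X → 𝒫 X × X x × ¬ ◇F R X y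
  separator {x} {y} ¬Ryx = em⇒dne em₁ λ no-separator →
    ¬Ryx (Equivalence.from (tig y x) λ X 𝒫X Xx →
      em⇒dne em₀ λ ¬◇Xy → no-separator (X , 𝒫X , Xx , ¬◇Xy))

  -- Applied to ∁ (◇F X), the premise yields some w R x outside ◇F X, which X x forbids.
  past-tight : ∀ {x y} → (∀ X → 𝒫 X → X y → ◇P R X x) → R y x
  past-tight {x} h = em⇒dne em₀ λ ¬Ryx →
    let (X , 𝒫X , Xx , ¬◇Xy) = separator ¬Ryx
        (w , ¬◇Xw , Rwx)     = h (∁ₛ (◇F R X)) (𝒫-∁ (𝒫-◇F 𝒫X)) ¬◇Xy
    in ¬◇Xw (x , Xx , Rwx)

R⁻Limit-of-R⁻Unbounded : (F : TemporalFrame) → Descriptive F →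
  ExcludedMiddle lzero → ExcludedMiddle (lsuc lzero) →
  let open TemporalFrame F in ∀ S → R⁻Unbounded F S → Σ W (IsR⁻Limit F S)
R⁻Limit-of-R⁻Unbounded F D em₀ em₁ S unbounded@((s₀ , Ss₀) , _)
  with Limit.limit (mirror F) (mirror-descriptive F D em₀ em₁) em₀ S s₀ Ss₀
                   (R⁻Unbounded⇒predecessor F em₀ unbounded)
... | c , c≺S , c-greatest = c , c≺S , λ (u , c≺u , u≺S) → c-greatest (u , u≺S , c≺u)

lemma5p3 : ExcludedMiddle lzero → ExcludedMiddle (lsuc lzero) →
    (n : ℕ) (F : TemporalFrame) → Descriptive F → NGenerated F n →
    let open TemporalFrame F in
      ((x : W) (ys : List W) → Unique ys → All (C F x) ys → length ys ≤ 2 ^ n)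
    × ((S : Subset W) → RUnbounded F S → Σ W λ c → IsRLimit F S c)
    × ((S : Subset W) → R⁻Unbounded F S → Σ W λ c → IsR⁻Limit F S c)
    × (Σ W λ c → IsRFinal F c)
    × (Σ W λ c → IsR⁻Final F c)
lemma5p3 em₀ em₁ n F D (g , _ , _ , g-generates) =
    ClusterSize.cluster-size F D em₀ g g-generates
  , RLimit-of-RUnbounded F D em₀
  , R⁻Limit-of-R⁻Unbounded F D em₀ em₁
  , RFinal-exists F D em₀
  , RFinal-exists (mirror F) (mirror-descriptive F D em₀ em₁) em₀
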